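{- Let $r\ge 4$ and let $G$ be a $K_r^{=}$-minor free graph on $n$ vertices. Suppose $A,B\subseteq V(G)$ are disjoint sets with $|A|=r-3$, $|B|=(1-\delta)n$ and $(1-2\delta)n>r$ (for some $\delta\ge 0$), such that $A$ induces a complete graph in $G$ and every vertex of $A$ is adjacent to every vertex of $B$ (i.e. $G$ contains the complete split graph $S_{|A\cup B|,|A|}$ with clique part $A$ and independent part $B$ as a subgraph). For any $u\in V(G)\setminus(A\cup B)$, let $$G^*=G-\{uv: v\in N_G(u)\}+\{uv: v\in A\}.$$ Then $G^*$ is $K_r^{=}$-minor free.
   Context: All graphs are finite and simple; $N_G(u)$ is the neighborhood of $u$. $G-M$ denotes deleting the edge set $M$ and $G+M'$ adding the edge set $M'$. $S_{m,t}=K_t\nabla\overline{K}_{m-t}$ is the join of a clique on $t$ vertices with an independent set on $m-t$ vertices. $K_r^{=}$ is the graph obtained from $K_r$ by deleting two edges sharing a common vertex. A graph $H$ is a minor of $G$ if $H$ can be obtained from $G$ by vertex deletions, edge deletions and edge contractions; $G$ is $H$-minor free if it has no $H$ minor. -}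

module Defs where

open import Data.Nat using (ℕ; zero; suc)
open import Data.Fin using (Fin; toℕ; punchIn; _≟_)
open import Data.Fin.Subset using (Subset)
open import Data.Bool using (Bool; true; false; _∧_; _∨_; not; if_then_else_)
open import Data.Vec using (lookup)
open import Data.Product using (Σ; _×_)
open import Relation.Nullary using (¬_)
open import Relation.Nullary.Decidable using (⌊_⌋)
open import Relation.Binary.PropositionalEquality using (_≡_; _≢_)
import Data.Nat as ℕ

Graph : ℕ → Set
Graph n = Fin n → Fin n → Bool

IsSimple : {n : ℕ} → Graph n → Set
IsSimple {n} G = ((x y : Fin n) → G x y ≡ G y x) × ((x : Fin n) → G x x ≡ false)

_==_ : {n : ℕ} → Fin n → Fin n → Bool
x == y = ⌊ x ≟ y ⌋

record Iso {n : ℕ} (H G : Graph n) : Set where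
  field
    to      : Fin n → Fin n
    from    : Fin n → Fin n
    to-from : (x : Fin n) → to (from x) ≡ x
    from-to : (x : Fin n) → from (to x) ≡ x
    adj-pres : (x y : Fin n) → H x y ≡ G (to x) (to y)

deleteVertex : {n : ℕ} → Graph (suc n) → Fin (suc n) → Graph n
deleteVertex G v x y = G (punchIn v x) (punchIn v y)

deleteEdge : {n : ℕ} → Graph n → Fin n → Fin n → Graph n
deleteEdge G u v x y = G x y ∧ not ((x == u ∧ y == v) ∨ (x == v ∧ y == u))

-- Contract the edge uv: v is merged into u (then removed); no loops created.
contract : {n : ℕ} → Graph (suc n) → Fin (suc n) → Fin (suc n) → Graph n
contract G u v x y =
  not (x == y) ∧ (G a b ∨ (a == u ∧ G v b) ∨ (b == u ∧ G a v))
  where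
    a = punchIn v x
    b = punchIn v y

data _≼_ : {m n : ℕ} → Graph m → Graph n → Set where
  ≼-iso   : {n : ℕ} (H G : Graph n) → Iso H G → H ≼ G
  ≼-trans : {m k n : ℕ} {H : Graph m} {F : Graph k} {G : Graph n} →
            H ≼ F → F ≼ G → H ≼ G
  ≼-delV  : {n : ℕ} (G : Graph (suc n)) (v : Fin (suc n)) → deleteVertex G v ≼ G
  ≼-delE  : {n : ℕ} (G : Graph n) (u v : Fin n) → deleteEdge G u v ≼ G
  ≼-contr : {n : ℕ} (G : Graph (suc n)) (u v : Fin (suc n)) →
            u ≢ v → G u v ≡ true → contract G u v ≼ G

MinorFree : {m n : ℕ} → Graph m → Graph n → Set
MinorFree H G = ¬ (H ≼ G)

removedPair : ℕ → ℕ → Bool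
removedPair 0 1 = true
removedPair 0 2 = true
removedPair 1 0 = true
removedPair 2 0 = true
removedPair _ _ = false

K=[_] : (r : ℕ) → Graph r
K=[ r ] x y = not (x == y) ∧ not (removedPair (toℕ x) (toℕ y))

rewire : {n : ℕ} → Graph n → Subset n → Fin n → Graph n
rewire G A u x y =
  if x == u then lookup A y
  else (if y == u then lookup A x else G x y)

-- Minors are handled through models (branch sets), which exist exactly when the minor relation
-- holds. Take a model of K_r^= in G*. If u is unused, or shares its branch set with another
-- vertex, u can simply be dropped: its neighbours in G* form the clique A, so walks and edges
-- through u are rerouted inside A. If u is alone in its branch set, all neighbours of its label
-- have branch sets meeting A, and |A| = r - 3 forces the label to be 0, the vertex of K_r^=
-- missing two edges; then labels 3,…,r-1 each meet A while 1 and 2 avoid it. Let D be the part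
-- of G - A reachable from branch 1. A vertex b ∈ B outside D, adjacent to all of A, can take
-- over branch 0. Otherwise a walk in G - A joins two vertices of B; its last stretch between
-- vertices of B, together with a third vertex of B and the clique A, is a K_r^= model in G.
-- Deciding membership in D is only done under a double negation, which suffices to refute
-- the existence of the minor.

module Submission where

open import Defs
open import Data.Bool using (Bool; true; false; _∧_; _∨_; not)
import Data.Bool.Properties as Boolₚ
open import Data.Empty using (⊥; ⊥-elim)
open import Data.Fin using (Fin; zero; suc; punchIn; punchOut; toℕ; _≟_)
import Data.Fin.Properties as Finₚ
open import Data.Fin.Subset using (Subset; _∈_; _∉_; ∣_∣; ⁅_⁆; _∪_; _⊆_; _-_)
import Data.Fin.Subset.Properties as Subsetₚ
open import Data.List using (List; []; _∷_; allFin; cartesianProduct)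
open import Data.Vec using ([]; _∷_; lookup)
open import Data.List.Membership.Propositional using () renaming (_∈_ to _∈ˡ_)
import Data.List.Membership.Propositional.Properties as Listₚ
open import Data.List.Relation.Unary.Any using (here; there)
open import Data.Maybe using (Maybe; just; nothing; _>>=_)
import Data.Maybe.Properties as Maybeₚ
import Data.Vec.Properties as Vecₚ
open import Data.Nat using (ℕ; zero; suc; _+_; _*_; _∸_; _<_; _≤_; z≤n; s≤s)
import Data.Nat.Properties as ℕₚ
open import Data.Product using (∃; ∃₂; _×_; _,_; proj₁; proj₂)
open import Function using (_∘_)
open import Data.Sum using (_⊎_; inj₁; inj₂)
open import Relation.Nullary using (¬_; Dec; yes; no; ¬?; ¬¬-excluded-middle)
open import Relation.Nullary.Decidable using (_×-dec_)
open import Relation.Binary.PropositionalEquality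
  using (_≡_; _≢_; refl; sym; trans; cong; cong₂; subst; subst₂; module ≡-Reasoning)

private
  variable
    k m n : ℕ

≡⇒== : {x y : Fin n} → x ≡ y → x == y ≡ true
≡⇒== {x = x} {y} x≡y with x ≟ y
... | yes _   = refl
... | no x≢y  = ⊥-elim (x≢y x≡y)

≢⇒== : {x y : Fin n} → x ≢ y → x == y ≡ false
≢⇒== {x = x} {y} x≢y with x ≟ y
... | yes x≡y = ⊥-elim (x≢y x≡y)
... | no _    = refl

==⇒≡ : {x y : Fin n} → x == y ≡ true → x ≡ y
==⇒≡ {x = x} {y} eq with x ≟ y
... | yes x≡y = x≡y

==-sym : (x y : Fin n) → x == y ≡ y == x
==-sym x y with x ≟ y
... | yes x≡y = sym (≡⇒== (sym x≡y))
... | no x≢y  = sym (≢⇒== (λ y≡x → x≢y (sym y≡x)))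

∨-true⁻ : {a b : Bool} → a ∨ b ≡ true → a ≡ true ⊎ b ≡ true
∨-true⁻ {true}  _  = inj₁ refl
∨-true⁻ {false} eq = inj₂ eq

∨-trueʳ : {a b : Bool} → b ≡ true → a ∨ b ≡ true
∨-trueʳ {true}  _  = refl
∨-trueʳ {false} eq = eq

Symmetric : Graph m → Set
Symmetric {m} H = (x y : Fin m) → H x y ≡ H y x

Irreflexive : Graph m → Set
Irreflexive {m} H = (x : Fin m) → H x x ≢ true

Adjacent : Graph n → Fin n → Fin n → Set
Adjacent G x y = G x y ≡ true ⊎ G y x ≡ true

Adjacent-sym : {G : Graph n} {x y : Fin n} → Adjacent G x y → Adjacent G y x
Adjacent-sym (inj₁ e) = inj₂ e
Adjacent-sym (inj₂ e) = inj₁ e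

Adjacent⇒edge : {G : Graph n} → Symmetric G → {x y : Fin n} → Adjacent G x y → G x y ≡ true
Adjacent⇒edge sym-G (inj₁ e) = e
Adjacent⇒edge sym-G (inj₂ e) = trans (sym-G _ _) e

data Walk (G : Graph n) (P : Fin n → Set) : Fin n → Fin n → Set where
  [_]    : {x : Fin n} → P x → Walk G P x x
  _∷⟨_⟩_ : {x y z : Fin n} → P x → Adjacent G x y → Walk G P y z → Walk G P x z

infixr 5 _∷⟨_⟩_

module _ {G : Graph n} {P : Fin n → Set} where

  head : {x y : Fin n} → Walk G P x y → P x
  head [ p ]          = p
  head (p ∷⟨ _ ⟩ _)   = p

  last : {x y : Fin n} → Walk G P x y → P y
  last [ p ]          = p
  last (_ ∷⟨ _ ⟩ w)   = last w

  infixr 5 _++ʷ_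

  _++ʷ_ : {x y z : Fin n} → Walk G P x y → Walk G P y z → Walk G P x z
  [ _ ]          ++ʷ w′ = w′
  (p ∷⟨ a ⟩ w)   ++ʷ w′ = p ∷⟨ a ⟩ (w ++ʷ w′)

  snoc : {x y z : Fin n} → Walk G P x y → Adjacent G y z → P z → Walk G P x z
  snoc w a pz = w ++ʷ (last w ∷⟨ a ⟩ [ pz ])

  reverse : {x y : Fin n} → Walk G P x y → Walk G P y x
  reverse [ p ]          = [ p ]
  reverse (p ∷⟨ a ⟩ w)   = snoc (reverse w) (Adjacent-sym {G = G} a) p

  trivial : {x y : Fin n} → x ≡ y → P x → Walk G P x y
  trivial refl p = [ p ]

mapᵛ : {G : Graph n} {P Q : Fin n → Set} → (∀ z → P z → Q z) →
       {x y : Fin n} → Walk G P x y → Walk G Q x y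
mapᵛ f [ p ]          = [ f _ p ]
mapᵛ f (p ∷⟨ a ⟩ w)   = f _ p ∷⟨ a ⟩ mapᵛ f w

mapᵉ : {G G′ : Graph n} {P : Fin n → Set} →
       (∀ a b → P a → P b → Adjacent G a b → Adjacent G′ a b) →
       {x y : Fin n} → Walk G P x y → Walk G′ P x y
mapᵉ f [ p ]          = [ p ]
mapᵉ f (p ∷⟨ a ⟩ w)   = p ∷⟨ f _ _ p (head w) a ⟩ mapᵉ f w

edge-on-walk : {G : Graph n} {P : Fin n → Set} {x y : Fin n} → Walk G P x y → x ≢ y →
               ∃₂ λ a b → P a × P b × a ≢ b × G a b ≡ true
edge-on-walk [ _ ] x≢x = ⊥-elim (x≢x refl)
edge-on-walk {x = x} (_∷⟨_⟩_ {y = z} p adj w) x≢y with x ≟ z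
... | yes refl = edge-on-walk w x≢y
... | no x≢z with adj
...   | inj₁ e = x , z , p , head w , x≢z , e
...   | inj₂ e = z , x , head w , p , (λ z≡x → x≢z (sym z≡x)) , e

vertices : {G : Graph n} {P : Fin n → Set} {x y : Fin n} → Walk G P x y → List (Fin n)
vertices {x = x} [ _ ]          = x ∷ []
vertices {x = x} (_ ∷⟨ _ ⟩ w)   = x ∷ vertices w

module _ {G : Graph n} {P : Fin n → Set} where

  ∈-vertices⁻ : {x y : Fin n} (w : Walk G P x y) {v : Fin n} → v ∈ˡ vertices w → P v
  ∈-vertices⁻ [ p ]          (here refl) = p
  ∈-vertices⁻ (p ∷⟨ _ ⟩ _)   (here refl) = p
  ∈-vertices⁻ (_ ∷⟨ _ ⟩ w)   (there v∈)  = ∈-vertices⁻ w v∈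

  start∈vertices : {x y : Fin n} (w : Walk G P x y) → x ∈ˡ vertices w
  start∈vertices [ _ ]          = here refl
  start∈vertices (_ ∷⟨ _ ⟩ _)   = here refl

  end∈vertices : {x y : Fin n} (w : Walk G P x y) → y ∈ˡ vertices w
  end∈vertices [ _ ]          = here refl
  end∈vertices (_ ∷⟨ _ ⟩ w)   = there (end∈vertices w)

  walk-within-vertices : {x y : Fin n} (w : Walk G P x y) {v : Fin n} → v ∈ˡ vertices w →
                         Walk G (_∈ˡ vertices w) v y
  walk-within-vertices [ _ ]          (here refl) = [ here refl ]
  walk-within-vertices (_ ∷⟨ a ⟩ w)   (here refl) =
    here refl ∷⟨ a ⟩ mapᵛ (λ _ → there) (walk-within-vertices w (start∈vertices w))
  walk-within-vertices (_ ∷⟨ _ ⟩ w)   (there v∈)  = mapᵛ (λ _ → there) (walk-within-vertices w v∈)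

Linked : Graph n → (Fin n → Maybe (Fin m)) → Fin m → Fin m → Set
Linked G β h h′ = ∃₂ λ x y → β x ≡ just h × β y ≡ just h′ × G x y ≡ true

Linked-sym : {G : Graph n} {β : Fin n → Maybe (Fin m)} {h h′ : Fin m} →
             Symmetric G → Linked G β h h′ → Linked G β h′ h
Linked-sym sym-G (x , y , βx , βy , xy) = y , x , βy , βx , trans (sym-G y x) xy

-- A model of H in G: branch x ≡ just h places x in the branch set of h,
-- branch x ≡ nothing leaves x unused.
record Model (H : Graph m) (G : Graph n) : Set where
  field
    branch    : Fin n → Maybe (Fin m)
    inhabited : ∀ h → ∃ λ x → branch x ≡ just h
    connected : ∀ h x y → branch x ≡ just h → branch y ≡ just h →
                Walk G (λ z → branch z ≡ just h) x y
    linked    : ∀ h h′ → H h h′ ≡ true → Linked G branch h h′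

open Model public

>>=-just⁻ : {A B : Set} (mx : Maybe A) {f : A → Maybe B} {b : B} →
            (mx >>= f) ≡ just b → ∃ λ a → mx ≡ just a × f a ≡ just b
>>=-just⁻ (just a) eq = a , refl , eq

>>=-just⁺ : {A B : Set} {mx : Maybe A} {f : A → Maybe B} {a : A} {b : B} →
            mx ≡ just a → f a ≡ just b → (mx >>= f) ≡ just b
>>=-just⁺ refl eq = eq

module _ {H : Graph m} {G : Graph n} where

  single-vertex-model : (σ : Fin m → Fin n) (ρ : Fin n → Maybe (Fin m)) →
    (∀ x h → ρ x ≡ just h → x ≡ σ h) → (∀ h → ρ (σ h) ≡ just h) →
    (∀ a b → H a b ≡ true → G (σ a) (σ b) ≡ true) → Model H G
  single-vertex-model σ ρ ρ⁻¹ ρ∘σ hom = record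
    { branch    = ρ
    ; inhabited = λ h → σ h , ρ∘σ h
    ; connected = λ h x y ρx ρy → trivial (trans (ρ⁻¹ x h ρx) (sym (ρ⁻¹ y h ρy))) ρx
    ; linked    = λ h h′ e → σ h , σ h′ , ρ∘σ h , ρ∘σ h′ , hom h h′ e
    }

punchOut? : Fin (suc n) → Fin (suc n) → Maybe (Fin n)
punchOut? v x with v ≟ x
... | yes _   = nothing
... | no v≢x  = just (punchOut v≢x)

punchOut?-just⁻ : (v x : Fin (suc n)) {h : Fin n} → punchOut? v x ≡ just h → x ≡ punchIn v h
punchOut?-just⁻ v x eq with v ≟ x
punchOut?-just⁻ v x refl | no v≢x = sym (Finₚ.punchIn-punchOut v≢x)

punchOut?-punchIn : (v : Fin (suc n)) (h : Fin n) → punchOut? v (punchIn v h) ≡ just h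
punchOut?-punchIn v h with v ≟ punchIn v h
... | yes v≡ = ⊥-elim (Finₚ.punchInᵢ≢i v h (sym v≡))
... | no v≢  = cong just (Finₚ.punchIn-injective v _ _ (Finₚ.punchIn-punchOut v≢))

-- The contracted vertex u′ has branch set {u, v}; every other vertex is a branch set by itself.
module ContractionModel (G : Graph (suc n)) (u v : Fin (suc n))
                        (u≢v : u ≢ v) (uv : G u v ≡ true) where

  v≢u : v ≢ u
  v≢u v≡u = u≢v (sym v≡u)

  u′ : Fin n
  u′ = punchOut v≢u

  merge : Fin (suc n) → Maybe (Fin n)
  merge x with v ≟ x
  ... | yes _   = just u′
  ... | no v≢x  = just (punchOut v≢x)

  merge-punchIn : ∀ h → merge (punchIn v h) ≡ just h
  merge-punchIn h with v ≟ punchIn v h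
  ... | yes v≡ = ⊥-elim (Finₚ.punchInᵢ≢i v h (sym v≡))
  ... | no v≢  = cong just (Finₚ.punchIn-injective v _ _ (Finₚ.punchIn-punchOut v≢))

  merge-v : ∀ h → punchIn v h ≡ u → merge v ≡ just h
  merge-v h eq with v ≟ v
  ... | yes _   = cong just (Finₚ.punchIn-injective v _ _ (trans (Finₚ.punchIn-punchOut v≢u) (sym eq)))
  ... | no v≢v  = ⊥-elim (v≢v refl)

  merge⁻ : ∀ x h → merge x ≡ just h → x ≡ punchIn v h ⊎ (x ≡ v × punchIn v h ≡ u)
  merge⁻ x h eq with v ≟ x
  merge⁻ x h refl | yes v≡x = inj₂ (sym v≡x , Finₚ.punchIn-punchOut v≢u)
  merge⁻ x h refl | no v≢x  = inj₁ (sym (Finₚ.punchIn-punchOut v≢x))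

  connected′ : ∀ h x y → merge x ≡ just h → merge y ≡ just h →
               Walk G (λ z → merge z ≡ just h) x y
  connected′ h x y mx my with merge⁻ x h mx | merge⁻ y h my
  ... | inj₁ x≡ | inj₁ y≡ = trivial (trans x≡ (sym y≡)) mx
  ... | inj₁ x≡ | inj₂ (refl , u≡) =
    subst (λ w → Walk G _ w v) (sym x≡u) (mu ∷⟨ inj₁ uv ⟩ [ my ])
    where x≡u = trans x≡ u≡
          mu  = subst (λ w → merge w ≡ just h) x≡u mx
  ... | inj₂ (refl , u≡) | inj₁ y≡ =
    subst (Walk G _ v) (sym y≡u) (mx ∷⟨ inj₂ uv ⟩ [ mu ])
    where y≡u = trans y≡ u≡
          mu  = subst (λ w → merge w ≡ just h) y≡u my
  ... | inj₂ (refl , _) | inj₂ (refl , _) = [ mx ]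

  linked′ : ∀ h h′ → contract G u v h h′ ≡ true → Linked G merge h h′
  linked′ h h′ e with ∨-true⁻ (Boolₚ.∧-conicalʳ _ _ e)
  ... | inj₁ g = punchIn v h , punchIn v h′ , merge-punchIn h , merge-punchIn h′ , g
  ... | inj₂ e′ with ∨-true⁻ e′
  ...   | inj₁ e″ = v , punchIn v h′ , merge-v h (==⇒≡ (Boolₚ.∧-conicalˡ _ _ e″)) ,
                    merge-punchIn h′ , Boolₚ.∧-conicalʳ _ _ e″
  ...   | inj₂ e″ = punchIn v h , v , merge-punchIn h , merge-v h′ (==⇒≡ (Boolₚ.∧-conicalˡ _ _ e″)) ,
                    Boolₚ.∧-conicalʳ _ _ e″

  model : Model (contract G u v) G
  model = record
    { branch    = merge
    ; inhabited = λ h → punchIn v h , merge-punchIn h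
    ; connected = connected′
    ; linked    = linked′
    }

module _ {H : Graph m} {F : Graph k} {G : Graph n} (M₁ : Model H F) (M₂ : Model F G) where

  private
    β : Fin n → Maybe (Fin m)
    β x = branch M₂ x >>= branch M₁

    lift : ∀ h {f f′} → Walk F (λ z → branch M₁ z ≡ just h) f f′ →
           ∀ x y → branch M₂ x ≡ just f → branch M₂ y ≡ just f′ → Walk G (λ z → β z ≡ just h) x y
    lift h [ pf ] x y px py = mapᵛ (λ z pz → >>=-just⁺ pz pf) (connected M₂ _ x y px py)
    lift h {f} (_∷⟨_⟩_ {y = g} pf adj rest) x y px py = entry adj
      where
      inside = λ z pz → >>=-just⁺ {f = branch M₁} pz pf
      entry : Adjacent F f g → Walk G (λ z → β z ≡ just h) x y
      entry (inj₁ e) with linked M₂ f g e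
      ... | x′ , y′ , px′ , py′ , e′ =
        mapᵛ inside (connected M₂ _ x x′ px px′) ++ʷ
          (inside x′ px′ ∷⟨ inj₁ e′ ⟩ lift h rest y′ y py′ py)
      entry (inj₂ e) with linked M₂ g f e
      ... | y′ , x′ , py′ , px′ , e′ =
        mapᵛ inside (connected M₂ _ x x′ px px′) ++ʷ
          (inside x′ px′ ∷⟨ inj₂ e′ ⟩ lift h rest y′ y py′ py)

  compose-models : Model H G
  compose-models = record
    { branch    = β
    ; inhabited = λ h → let f , pf = inhabited M₁ h ; x , px = inhabited M₂ f in x , >>=-just⁺ px pf
    ; connected = λ h x y px py →
        let f , ef , pf = >>=-just⁻ (branch M₂ x) px
            f′ , ef′ , pf′ = >>=-just⁻ (branch M₂ y) py
        in lift h (connected M₁ h f f′ pf pf′) x y ef ef′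
    ; linked = λ h h′ e →
        let f , f′ , pf , pf′ , ef = linked M₁ h h′ e
            x , y , px , py , ex = linked M₂ f f′ ef
        in x , y , >>=-just⁺ px pf , >>=-just⁺ py pf′ , ex
    }

≼⇒Model : {H : Graph m} {G : Graph n} → H ≼ G → Model H G
≼⇒Model (≼-iso H G I) = single-vertex-model to (λ x → just (from x))
  (λ x h eq → trans (sym (to-from x)) (cong to (Maybeₚ.just-injective eq)))
  (λ h → cong just (from-to h))
  (λ a b e → trans (sym (adj-pres a b)) e)
  where open Iso I
≼⇒Model (≼-trans H≼F F≼G) = compose-models (≼⇒Model H≼F) (≼⇒Model F≼G)
≼⇒Model (≼-delV G v) =
  single-vertex-model (punchIn v) (punchOut? v) (λ x h → punchOut?-just⁻ v x) (punchOut?-punchIn v)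
                      (λ a b e → e)
≼⇒Model (≼-delE G u v) =
  single-vertex-model (λ x → x) just (λ x h → Maybeₚ.just-injective) (λ h → refl)
                      (λ a b e → Boolₚ.∧-conicalˡ _ _ e)
≼⇒Model (≼-contr G u v u≢v uv) = ContractionModel.model G u v u≢v uv

≗⇒≼ : {H G : Graph n} → (∀ x y → H x y ≡ G x y) → H ≼ G
≗⇒≼ {H = H} {G} H≗G = ≼-iso H G (record
  { to = λ x → x ; from = λ x → x ; to-from = λ _ → refl ; from-to = λ _ → refl ; adj-pres = H≗G })

deleteEdge-removes : (G : Graph n) (x y : Fin n) → deleteEdge G x y x y ≡ false
deleteEdge-removes G x y rewrite ≡⇒== {x = x} refl | ≡⇒== {x = y} refl = Boolₚ.∧-zeroʳ (G x y)

deleteEdge-keeps : (G : Graph n) {a b x y : Fin n} → G x y ≡ true →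
                   ¬ (x ≡ a × y ≡ b) → ¬ (x ≡ b × y ≡ a) → deleteEdge G a b x y ≡ true
deleteEdge-keeps G {a} {b} {x} {y} e ¬ab ¬ba with x == a ∧ y == b in eab | x == b ∧ y == a in eba
... | true  | _    = ⊥-elim (¬ab (==⇒≡ (Boolₚ.∧-conicalˡ _ _ eab) , ==⇒≡ (Boolₚ.∧-conicalʳ _ _ eab)))
... | false | true = ⊥-elim (¬ba (==⇒≡ (Boolₚ.∧-conicalˡ _ _ eba) , ==⇒≡ (Boolₚ.∧-conicalʳ _ _ eba)))
... | false | false rewrite e = refl

-- G′ is obtained from G by deleting, one pair at a time, every pair that is not an edge of G′.
module _ {G′ G : Graph n} (sym-G′ : Symmetric G′) (G′⊆G : ∀ x y → G′ x y ≡ true → G x y ≡ true) where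

  private
    prune : List (Fin n × Fin n) → Graph n
    prune [] = G
    prune ((a , b) ∷ ps) with G′ a b
    ... | true  = prune ps
    ... | false = deleteEdge (prune ps) a b

    prune≼ : ∀ ps → prune ps ≼ G
    prune≼ [] = ≗⇒≼ (λ _ _ → refl)
    prune≼ ((a , b) ∷ ps) with G′ a b
    ... | true  = prune≼ ps
    ... | false = ≼-trans (≼-delE (prune ps) a b) (prune≼ ps)

    prune-keeps : ∀ ps x y → G′ x y ≡ true → prune ps x y ≡ true
    prune-keeps [] x y e = G′⊆G x y e
    prune-keeps ((a , b) ∷ ps) x y e with G′ a b in eab
    ... | true  = prune-keeps ps x y e
    ... | false = deleteEdge-keeps (prune ps) (prune-keeps ps x y e)
      (λ { (refl , refl) → true≢false (trans (sym e) eab) })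
      (λ { (refl , refl) → true≢false (trans (sym e) (trans (sym-G′ b a) eab)) })
      where true≢false : true ≢ false
            true≢false ()

    prune-removes : ∀ ps x y → (x , y) ∈ˡ ps → G′ x y ≡ false → prune ps x y ≡ false
    prune-removes ((a , b) ∷ ps) x y (here refl) e with G′ x y
    ... | false = deleteEdge-removes (prune ps) x y
    prune-removes ((a , b) ∷ ps) x y (there xy∈) e with G′ a b
    ... | true  = prune-removes ps x y xy∈ e
    ... | false rewrite prune-removes ps x y xy∈ e = refl

    all-pairs : List (Fin n × Fin n)
    all-pairs = cartesianProduct (allFin n) (allFin n)

    ∈-all-pairs : ∀ x y → (x , y) ∈ˡ all-pairs
    ∈-all-pairs x y = Listₚ.∈-cartesianProduct⁺ (Listₚ.∈-allFin x) (Listₚ.∈-allFin y)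

    G′≗prune : ∀ x y → G′ x y ≡ prune all-pairs x y
    G′≗prune x y with G′ x y in e
    ... | true  = sym (prune-keeps all-pairs x y e)
    ... | false = sym (prune-removes all-pairs x y (∈-all-pairs x y) e)

  subgraph⇒≼ : G′ ≼ G
  subgraph⇒≼ = ≼-trans (≗⇒≼ G′≗prune) (prune≼ all-pairs)

relabelling⇒≼ : {H : Graph m} {G : Graph n} → m ≡ n → Symmetric H →
  (σ : Fin n → Fin m) (τ : Fin m → Fin n) → (∀ h → σ (τ h) ≡ h) → (∀ x → τ (σ x) ≡ x) →
  (∀ x y → H (σ x) (σ y) ≡ true → G x y ≡ true) → H ≼ G
relabelling⇒≼ {H = H} {G} refl sym-H σ τ σ∘τ τ∘σ H⊆G =
  ≼-trans (≼-iso H H∘σ iso) (subgraph⇒≼ (λ x y → sym-H (σ x) (σ y)) H⊆G)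
  where
  H∘σ : Graph _
  H∘σ x y = H (σ x) (σ y)
  iso : Iso H H∘σ
  iso = record { to = τ ; from = σ ; to-from = τ∘σ ; from-to = σ∘τ
               ; adj-pres = λ x y → sym (cong₂ H (σ∘τ x) (σ∘τ y)) }

walk-deleteVertex : {G : Graph (suc n)} {P : Fin (suc n) → Set} (v : Fin (suc n)) →
  (∀ z → P z → z ≢ v) → {x y : Fin (suc n)} → Walk G P x y →
  ∀ x′ y′ → x ≡ punchIn v x′ → y ≡ punchIn v y′ → Walk (deleteVertex G v) (λ z → P (punchIn v z)) x′ y′
walk-deleteVertex {P = P} v avoids [ p ] x′ y′ x≡ y≡ =
  trivial (Finₚ.punchIn-injective v _ _ (trans (sym x≡) y≡)) (subst P x≡ p)
walk-deleteVertex {G = G} {P} v avoids (_∷⟨_⟩_ {y = z} p adj w) x′ y′ x≡ y≡ =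
  subst P x≡ p ∷⟨ subst₂ (Adjacent G) x≡ z≡ adj ⟩ walk-deleteVertex v avoids w z′ y′ z≡ y≡
  where
  v≢z : v ≢ z
  v≢z v≡z = avoids z (head w) (sym v≡z)
  z′ = punchOut v≢z
  z≡ : z ≡ punchIn v z′
  z≡ = sym (Finₚ.punchIn-punchOut v≢z)

module _ {H : Graph m} where

  Model-deleteVertex : {G : Graph (suc n)} (M : Model H G) (v : Fin (suc n)) →
                       branch M v ≡ nothing → Model H (deleteVertex G v)
  Model-deleteVertex {G = G} M v unused = record
    { branch    = λ x → branch M (punchIn v x)
    ; inhabited = λ h → let x , px = inhabited M h in
                        punchOut (v≢ px) , subst (λ w → branch M w ≡ just h) (sym (punchIn-punchOut-v px)) px
    ; connected = λ h x y px py →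
        walk-deleteVertex v (λ z pz → v≢ pz ∘ sym) (connected M h _ _ px py) x y refl refl
    ; linked    = λ h h′ e → let x , y , px , py , xy = linked M h h′ e in
        punchOut (v≢ px) , punchOut (v≢ py) ,
        subst (λ w → branch M w ≡ just h) (sym (punchIn-punchOut-v px)) px ,
        subst (λ w → branch M w ≡ just h′) (sym (punchIn-punchOut-v py)) py ,
        subst₂ (λ w w′ → G w w′ ≡ true) (sym (punchIn-punchOut-v px)) (sym (punchIn-punchOut-v py)) xy
    }
    where
    v≢ : ∀ {x h} → branch M x ≡ just h → v ≢ x
    v≢ px refl with trans (sym px) unused
    ... | ()
    punchIn-punchOut-v : ∀ {x h} (px : branch M x ≡ just h) → punchIn v (punchOut (v≢ px)) ≡ x
    punchIn-punchOut-v px = Finₚ.punchIn-punchOut (v≢ px)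

  module ContractInBranch (irr-H : Irreflexive H) {G : Graph (suc n)} (M : Model H G)
    {a b : Fin (suc n)} {h : Fin m} (pa : branch M a ≡ just h) (pb : branch M b ≡ just h)
    (a≢b : a ≢ b) (ab : G a b ≡ true) where

    private
      b≢a : b ≢ a
      b≢a b≡a = a≢b (sym b≡a)

    squash : Fin (suc n) → Fin n
    squash z with b ≟ z
    ... | yes _   = punchOut b≢a
    ... | no b≢z  = punchOut b≢z

    punchIn-squash : ∀ z → b ≢ z → punchIn b (squash z) ≡ z
    punchIn-squash z b≢z with b ≟ z
    ... | yes b≡z = ⊥-elim (b≢z b≡z)
    ... | no b≢z  = Finₚ.punchIn-punchOut b≢z

    punchIn-squash-b : punchIn b (squash b) ≡ a
    punchIn-squash-b with b ≟ b
    ... | yes _   = Finₚ.punchIn-punchOut b≢a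
    ... | no b≢b  = ⊥-elim (b≢b refl)

    branch-squash : ∀ z → branch M (punchIn b (squash z)) ≡ branch M z
    branch-squash z with b ≟ z
    ... | yes refl = trans (cong (branch M) (Finₚ.punchIn-punchOut b≢a)) (trans pa (sym pb))
    ... | no b≢z   = cong (branch M) (Finₚ.punchIn-punchOut b≢z)

    squash-punchIn : ∀ y → squash (punchIn b y) ≡ y
    squash-punchIn y = Finₚ.punchIn-injective b _ _
      (punchIn-squash (punchIn b y) (λ b≡ → Finₚ.punchInᵢ≢i b y (sym b≡)))

    contract⁺ : ∀ p q → p ≢ q →
      G (punchIn b p) (punchIn b q) ≡ true ⊎
      (punchIn b p ≡ a × G b (punchIn b q) ≡ true) ⊎ (punchIn b q ≡ a × G (punchIn b p) b ≡ true) →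
      contract G a b p q ≡ true
    contract⁺ p q p≢q c rewrite ≢⇒== p≢q with c
    ... | inj₁ e rewrite e = refl
    ... | inj₂ (inj₁ (p≡ , e)) rewrite ≡⇒== p≡ | e = ∨-trueʳ {G (punchIn b p) (punchIn b q)} refl
    ... | inj₂ (inj₂ (q≡ , e)) rewrite ≡⇒== q≡ | e =
      ∨-trueʳ {G (punchIn b p) (punchIn b q)} (∨-trueʳ {punchIn b p == a ∧ G b (punchIn b q)} refl)

    squash-edge : ∀ s t → G s t ≡ true → squash s ≢ squash t → contract G a b (squash s) (squash t) ≡ true
    squash-edge s t e s≢t = by-cases (b ≟ s) (b ≟ t)
      where
      by-cases : Dec (b ≡ s) → Dec (b ≡ t) → contract G a b (squash s) (squash t) ≡ true
      by-cases (yes b≡s) (yes b≡t) = ⊥-elim (s≢t (cong squash (trans (sym b≡s) b≡t)))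
      by-cases (yes refl) (no b≢t) = contract⁺ _ _ s≢t (inj₂ (inj₁ (punchIn-squash-b ,
        subst (λ w → G b w ≡ true) (sym (punchIn-squash t b≢t)) e)))
      by-cases (no b≢s) (yes refl) = contract⁺ _ _ s≢t (inj₂ (inj₂ (punchIn-squash-b ,
        subst (λ w → G w b ≡ true) (sym (punchIn-squash s b≢s)) e)))
      by-cases (no b≢s) (no b≢t) = contract⁺ _ _ s≢t (inj₁
        (subst₂ (λ w w′ → G w w′ ≡ true) (sym (punchIn-squash s b≢s)) (sym (punchIn-squash t b≢t)) e))

    squash-walk : ∀ h′ {x y} → Walk G (λ z → branch M z ≡ just h′) x y →
                  Walk (contract G a b) (λ z → branch M (punchIn b z) ≡ just h′) (squash x) (squash y)
    squash-walk h′ [ p ] = [ trans (branch-squash _) p ]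
    squash-walk h′ (_∷⟨_⟩_ {x = x} {y = z} p adj w) with squash x ≟ squash z
    ... | yes eq = subst (λ q → Walk _ _ q _) (sym eq) (squash-walk h′ w)
    ... | no x≢z = trans (branch-squash x) p ∷⟨ squash-adj adj ⟩ squash-walk h′ w
      where
      squash-adj : Adjacent G x z → Adjacent (contract G a b) (squash x) (squash z)
      squash-adj (inj₁ e) = inj₁ (squash-edge x z e x≢z)
      squash-adj (inj₂ e) = inj₂ (squash-edge z x e (x≢z ∘ sym))

    model : Model H (contract G a b)
    model = record
      { branch    = branch M ∘ punchIn b
      ; inhabited = λ h′ → let z , pz = inhabited M h′ in squash z , trans (branch-squash z) pz
      ; connected = λ h′ y₁ y₂ p₁ p₂ →
          subst₂ (Walk _ _) (squash-punchIn y₁) (squash-punchIn y₂)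
                 (squash-walk h′ (connected M h′ _ _ p₁ p₂))
      ; linked    = linked′
      }
      where
      linked′ : ∀ h₁ h₂ → H h₁ h₂ ≡ true → Linked (contract G a b) (branch M ∘ punchIn b) h₁ h₂
      linked′ h₁ h₂ e with linked M h₁ h₂ e
      ... | s , t , ps , pt , st with squash s ≟ squash t
      ...   | no s≢t = squash s , squash t , trans (branch-squash s) ps , trans (branch-squash t) pt ,
                     squash-edge s t st s≢t
      ...   | yes eq = ⊥-elim (irr-H h₁ (subst (λ w → H h₁ w ≡ true) (sym h₁≡h₂) e))
        where
        h₁≡h₂ : h₁ ≡ h₂
        h₁≡h₂ = Maybeₚ.just-injective (begin
          just h₁                          ≡⟨ sym ps ⟩
          branch M s                       ≡⟨ sym (branch-squash s) ⟩
          branch M (punchIn b (squash s))  ≡⟨ cong (branch M ∘ punchIn b) eq ⟩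
          branch M (punchIn b (squash t))  ≡⟨ branch-squash t ⟩
          branch M t                       ≡⟨ pt ⟩
          just h₂                          ∎)
          where open ≡-Reasoning

  bijective-model⇒≼ : Symmetric H → {G : Graph n} (M : Model H G) →
    (∀ x → branch M x ≢ nothing) → (∀ x y → branch M x ≡ branch M y → x ≡ y) → H ≼ G
  bijective-model⇒≼ {n} sym-H {G} M used injective =
    relabelling⇒≼ (ℕₚ.≤-antisym (Finₚ.injective⇒≤ τ-injective) (Finₚ.injective⇒≤ σ-injective))
                  sym-H σ τ σ∘τ τ∘σ H⊆G
    where
    label : ∀ x → ∃ λ h → branch M x ≡ just h
    label x with branch M x in eq
    ... | nothing = ⊥-elim (used x eq)
    ... | just h  = h , refl
    σ : Fin n → Fin m
    σ x = proj₁ (label x)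
    τ : Fin m → Fin n
    τ h = proj₁ (inhabited M h)
    σ∘τ : ∀ h → σ (τ h) ≡ h
    σ∘τ h = Maybeₚ.just-injective (trans (sym (proj₂ (label (τ h)))) (proj₂ (inhabited M h)))
    τ∘σ : ∀ x → τ (σ x) ≡ x
    τ∘σ x = injective _ _ (trans (proj₂ (inhabited M (σ x))) (sym (proj₂ (label x))))
    τ-injective : ∀ {h h′} → τ h ≡ τ h′ → h ≡ h′
    τ-injective {h} {h′} eq = trans (sym (σ∘τ h)) (trans (cong σ eq) (σ∘τ h′))
    σ-injective : ∀ {x y} → σ x ≡ σ y → x ≡ y
    σ-injective {x} {y} eq = trans (sym (τ∘σ x)) (trans (cong τ eq) (τ∘σ y))
    in-branch : ∀ {x z} → branch M z ≡ just (σ x) → z ≡ x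
    in-branch {x} {z} pz = injective z x (trans pz (sym (proj₂ (label x))))
    H⊆G : ∀ x y → H (σ x) (σ y) ≡ true → G x y ≡ true
    H⊆G x y e = let s , t , ps , pt , st = linked M (σ x) (σ y) e in
      subst₂ (λ w w′ → G w w′ ≡ true) (in-branch ps) (in-branch pt) st

  -- Delete unused vertices and contract edges inside branch sets until every branch set is a single vertex.
  Model⇒≼ : Symmetric H → Irreflexive H → ∀ n {G : Graph n} → Model H G → H ≼ G
  Model⇒≼ sym-H irr-H zero M = bijective-model⇒≼ sym-H M (λ ()) (λ ())
  Model⇒≼ sym-H irr-H (suc n) {G} M with Finₚ.any? (λ x → Maybeₚ.≡-dec _≟_ (branch M x) nothing)
  ... | yes (v , unused) = ≼-trans (Model⇒≼ sym-H irr-H n (Model-deleteVertex M v unused)) (≼-delV G v)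
  ... | no none-unused
      with Finₚ.any? (λ x → Finₚ.any? (λ y → ¬? (x ≟ y) ×-dec Maybeₚ.≡-dec _≟_ (branch M x) (branch M y)))
  ...   | no none-shared = bijective-model⇒≼ sym-H M (λ x unused → none-unused (x , unused)) injective
    where
    injective : ∀ x y → branch M x ≡ branch M y → x ≡ y
    injective x y eq with x ≟ y
    ... | yes x≡y = x≡y
    ... | no x≢y  = ⊥-elim (none-shared (x , y , x≢y , eq))
  ...   | yes (x , y , x≢y , eq) with branch M x in px
  ...     | nothing = ⊥-elim (none-unused (x , px))
  ...     | just h with edge-on-walk (connected M h x y px (sym eq)) x≢y
  ...       | a , b , pa , pb , a≢b , ab =
    ≼-trans (Model⇒≼ sym-H irr-H n (ContractInBranch.model irr-H M pa pb a≢b ab)) (≼-contr G a b a≢b ab)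

injective⇒≤∣p∣ : (A : Subset n) (f : Fin k → Fin n) → (∀ {i j} → f i ≡ f j → i ≡ j) →
                 (∀ i → f i ∈ A) → k ≤ ∣ A ∣
injective⇒≤∣p∣ {k = zero}  A f f-inj f∈A = z≤n
injective⇒≤∣p∣ {k = suc k} A f f-inj f∈A = ℕₚ.≤-<-trans
  (injective⇒≤∣p∣ (A - f zero) (f ∘ suc) (λ eq → Finₚ.suc-injective (f-inj eq))
    (λ i → Subsetₚ.x∈p∧x≢y⇒x∈p-y (f∈A (suc i)) (λ eq → Finₚ.0≢1+n (sym (f-inj eq)))))
  (Subsetₚ.x∈p⇒∣p-x∣<∣p∣ (f∈A zero))

∣p∪q∣≤∣p∣+∣q∣ : (p q : Subset n) → ∣ p ∪ q ∣ ≤ ∣ p ∣ + ∣ q ∣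
∣p∪q∣≤∣p∣+∣q∣ []           []           = z≤n
∣p∪q∣≤∣p∣+∣q∣ (true ∷ p)  (s ∷ q)      =
  s≤s (ℕₚ.≤-trans (∣p∪q∣≤∣p∣+∣q∣ p q) (ℕₚ.+-monoʳ-≤ ∣ p ∣ (Subsetₚ.∣p∣≤∣x∷p∣ s q)))
∣p∪q∣≤∣p∣+∣q∣ (false ∷ p) (true ∷ q)  =
  ℕₚ.≤-trans (s≤s (∣p∪q∣≤∣p∣+∣q∣ p q)) (ℕₚ.≤-reflexive (sym (ℕₚ.+-suc ∣ p ∣ ∣ q ∣)))
∣p∪q∣≤∣p∣+∣q∣ (false ∷ p) (false ∷ q) = ∣p∪q∣≤∣p∣+∣q∣ p q

∣q∣<∣p∣⇒∃∈p∉q : {p q : Subset n} → ∣ q ∣ < ∣ p ∣ → ∃ λ x → x ∈ p × x ∉ q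
∣q∣<∣p∣⇒∃∈p∉q {p = p} {q} lt with Finₚ.any? (λ x → x Subsetₚ.∈? p ×-dec ¬? (x Subsetₚ.∈? q))
... | yes witness = witness
... | no none     = ⊥-elim (ℕₚ.<⇒≱ lt (Subsetₚ.p⊆q⇒∣p∣≤∣q∣ p⊆q))
  where
  p⊆q : p ⊆ q
  p⊆q {x} x∈p with x Subsetₚ.∈? q
  ... | yes x∈q = x∈q
  ... | no x∉q  = ⊥-elim (none (x , x∈p , x∉q))

∃∈p-avoiding-two : {p : Subset n} → 2 < ∣ p ∣ → (x y : Fin n) → ∃ λ z → z ∈ p × z ≢ x × z ≢ y
∃∈p-avoiding-two {p = p} lt x y =
  let z , z∈p , z∉q = ∣q∣<∣p∣⇒∃∈p∉q {q = ⁅ x ⁆ ∪ ⁅ y ⁆} (ℕₚ.≤-<-trans ∣q∣≤2 lt)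
  in z , z∈p , (λ z≡x → z∉q (Subsetₚ.p⊆p∪q ⁅ y ⁆ (subst (_∈ ⁅ x ⁆) (sym z≡x) (Subsetₚ.x∈⁅x⁆ x))))
             , (λ z≡y → z∉q (Subsetₚ.q⊆p∪q ⁅ x ⁆ ⁅ y ⁆ (subst (_∈ ⁅ y ⁆) (sym z≡y) (Subsetₚ.x∈⁅x⁆ y))))
  where
  ∣q∣≤2 : ∣ ⁅ x ⁆ ∪ ⁅ y ⁆ ∣ ≤ 2
  ∣q∣≤2 = ℕₚ.≤-trans (∣p∪q∣≤∣p∣+∣q∣ ⁅ x ⁆ ⁅ y ⁆)
                     (ℕₚ.≤-reflexive (cong₂ _+_ (Subsetₚ.∣⁅x⁆∣≡1 x) (Subsetₚ.∣⁅x⁆∣≡1 y)))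

module _ {l : ℕ} (A : Subset n) (β : Fin n → Maybe (Fin l)) where

  Meets : Fin l → Set
  Meets j = ∃ λ a → a ∈ A × β a ≡ just j

  meeting-labels⇒≤∣p∣ : (f : Fin k → Fin l) → (∀ {i j} → f i ≡ f j → i ≡ j) → (∀ i → Meets (f i)) → k ≤ ∣ A ∣
  meeting-labels⇒≤∣p∣ f f-inj meets = injective⇒≤∣p∣ A (proj₁ ∘ meets) rep-inj (proj₁ ∘ proj₂ ∘ meets)
    where
    rep-inj : ∀ {i j} → proj₁ (meets i) ≡ proj₁ (meets j) → i ≡ j
    rep-inj {i} {j} eq = f-inj (Maybeₚ.just-injective
      (trans (sym (proj₂ (proj₂ (meets i)))) (trans (cong β eq) (proj₂ (proj₂ (meets j))))))

all-but-two-meet⇒≤∣p∣ : (A : Subset n) (β : Fin n → Maybe (Fin (suc (suc k)))) {p q : Fin (suc (suc k))} →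
  p ≢ q → (∀ j → j ≢ p → j ≢ q → Meets A β j) → k ≤ ∣ A ∣
all-but-two-meet⇒≤∣p∣ A β {p} {q} p≢q meets =
  meeting-labels⇒≤∣p∣ A β skip (λ eq → Finₚ.punchIn-injective q′ _ _ (Finₚ.punchIn-injective p _ _ eq))
    (λ i → meets (skip i) (Finₚ.punchInᵢ≢i p _) (skip≢q i))
  where
  q′ = punchOut p≢q
  skip : Fin _ → Fin _
  skip i = punchIn p (punchIn q′ i)
  skip≢q : ∀ i → skip i ≢ q
  skip≢q i eq = Finₚ.punchInᵢ≢i q′ i
    (Finₚ.punchIn-injective p _ _ (trans eq (sym (Finₚ.punchIn-punchOut p≢q))))

¬¬-decidable : (P : Fin n → Set) → ¬ ¬ (∀ x → Dec (P x))
¬¬-decidable {zero}  P k = k (λ ())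
¬¬-decidable {suc n} P k = ¬¬-excluded-middle λ P₀? →
  ¬¬-decidable (P ∘ suc) λ P₊? → k λ { zero → P₀? ; (suc x) → P₊? x }

removedPair-suc : ∀ a b → removedPair (suc a) (suc b) ≡ false
removedPair-suc zero          b = refl
removedPair-suc (suc zero)    b = refl
removedPair-suc (suc (suc a)) b = refl

removedPair-sym : ∀ a b → removedPair a b ≡ removedPair b a
removedPair-sym 0 0                     = refl
removedPair-sym 0 1                     = refl
removedPair-sym 0 2                     = refl
removedPair-sym 0 (suc (suc (suc b)))   = refl
removedPair-sym 1 0                     = refl
removedPair-sym 2 0                     = refl
removedPair-sym (suc (suc (suc a))) 0   = refl
removedPair-sym (suc a) (suc b)         = trans (removedPair-suc a b) (sym (removedPair-suc b a))

K=-sym : ∀ r → Symmetric K=[ r ]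
K=-sym r x y = cong₂ (λ a b → not a ∧ not b) (==-sym x y) (removedPair-sym (toℕ x) (toℕ y))

K=-irr : ∀ r → Irreflexive K=[ r ]
K=-irr r x e rewrite ≡⇒== {x = x} refl with e
... | ()

K=-suc-suc : ∀ r (x y : Fin r) → x ≢ y → K=[ suc r ] (suc x) (suc y) ≡ true
K=-suc-suc r x y x≢y
  rewrite ≢⇒== {x = suc x} {suc y} (x≢y ∘ Finₚ.suc-injective) | removedPair-suc (toℕ x) (toℕ y) = refl

module _ {r : ℕ} {G : Graph n} (sym-G : Symmetric G) (β : Fin n → Maybe (Fin (suc (suc (suc r))))) where

  K=-linked :
    (∀ i → Linked G β zero (suc (suc (suc i)))) →
    Linked G β (suc zero) (suc (suc zero)) →
    (∀ i → Linked G β (suc zero) (suc (suc (suc i)))) →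
    (∀ i → Linked G β (suc (suc zero)) (suc (suc (suc i)))) →
    (∀ i i′ → i ≢ i′ → Linked G β (suc (suc (suc i))) (suc (suc (suc i′)))) →
    ∀ h h′ → K=[ suc (suc (suc r)) ] h h′ ≡ true → Linked G β h h′
  K=-linked 0-A 1-2 1-A 2-A A-A = links
    where
    K = K=[ suc (suc (suc r)) ]
    links : ∀ h h′ → K h h′ ≡ true → Linked G β h h′
    links zero                zero                e = ⊥-elim (K=-irr (suc (suc (suc r))) zero e)
    links zero                (suc zero)          ()
    links zero                (suc (suc zero))    ()
    links zero                (suc (suc (suc i))) e = 0-A i
    links (suc zero)          zero                ()
    links (suc (suc zero))    zero                ()
    links (suc zero)          (suc zero)          e = ⊥-elim (K=-irr (suc (suc (suc r))) (suc zero) e)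
    links (suc zero)          (suc (suc zero))    e = 1-2
    links (suc zero)          (suc (suc (suc i))) e = 1-A i
    links (suc (suc zero))    (suc (suc zero))    e = ⊥-elim (K=-irr (suc (suc (suc r))) (suc (suc zero)) e)
    links (suc (suc zero))    (suc (suc (suc i))) e = 2-A i
    links (suc (suc (suc i))) (suc (suc (suc i′))) e =
      A-A i i′ λ { refl → K=-irr (suc (suc (suc r))) (suc (suc (suc i))) e }
    links (suc (suc (suc i))) zero                e = Linked-sym {β = β} sym-G (0-A i)
    links (suc (suc zero))    (suc zero)          e = Linked-sym {β = β} sym-G 1-2
    links (suc (suc (suc i))) (suc zero)          e = Linked-sym {β = β} sym-G (1-A i)
    links (suc (suc (suc i))) (suc (suc zero))    e = Linked-sym {β = β} sym-G (2-A i)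

module Rewire (G : Graph n) (A : Subset n) (u : Fin n) where

  rewire-≢ : {x y : Fin n} → x ≢ u → y ≢ u → rewire G A u x y ≡ G x y
  rewire-≢ x≢u y≢u rewrite ≢⇒== x≢u | ≢⇒== y≢u = refl

  rewire-from-u : (y : Fin n) → rewire G A u u y ≡ lookup A y
  rewire-from-u y rewrite ≡⇒== {x = u} refl = refl

  rewire-to-u : (x : Fin n) → rewire G A u x u ≡ lookup A x
  rewire-to-u x with x ≟ u
  ... | yes x≡u = cong (lookup A) (sym x≡u)
  ... | no x≢u rewrite ≡⇒== {x = u} refl = refl

  rewire-neighbour : {x : Fin n} → Adjacent (rewire G A u) x u → x ∈ A
  rewire-neighbour {x} (inj₁ e) = Vecₚ.lookup⇒[]= x A (trans (sym (rewire-to-u x)) e)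
  rewire-neighbour {x} (inj₂ e) = Vecₚ.lookup⇒[]= x A (trans (sym (rewire-from-u x)) e)

  rewire⇒edge : {x y : Fin n} → x ≢ u → y ≢ u → rewire G A u x y ≡ true → G x y ≡ true
  rewire⇒edge x≢u y≢u e = trans (sym (rewire-≢ x≢u y≢u)) e

  rewire⇒adjacent : {x y : Fin n} → x ≢ u → y ≢ u → Adjacent (rewire G A u) x y → Adjacent G x y
  rewire⇒adjacent x≢u y≢u (inj₁ e) = inj₁ (rewire⇒edge x≢u y≢u e)
  rewire⇒adjacent x≢u y≢u (inj₂ e) = inj₂ (rewire⇒edge y≢u x≢u e)

  rewire⇒walk : {P : Fin n → Set} → (∀ z → P z → z ≢ u) → {x y : Fin n} →
                Walk (rewire G A u) P x y → Walk G P x y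
  rewire⇒walk avoids = mapᵉ (λ a b pa pb → rewire⇒adjacent (avoids a pa) (avoids b pb))

  unused⇒≢u : {H : Graph m} (M : Model H (rewire G A u)) → branch M u ≡ nothing →
              {x : Fin n} {h : Fin m} → branch M x ≡ just h → x ≢ u
  unused⇒≢u M unused βx refl with trans (sym βx) unused
  ... | ()

  Model-rewire-unused : {H : Graph m} (M : Model H (rewire G A u)) → branch M u ≡ nothing → Model H G
  Model-rewire-unused M unused = record
    { branch    = branch M
    ; inhabited = inhabited M
    ; connected = λ h x y βx βy → rewire⇒walk (λ z βz → unused⇒≢u M unused βz) (connected M h x y βx βy)
    ; linked    = λ h h′ e → let x , y , βx , βy , xy = linked M h h′ e in
        x , y , βx , βy , rewire⇒edge (unused⇒≢u M unused βx) (unused⇒≢u M unused βy) xy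
    }

module _ {G : Graph n} {A : Subset n} (A-clique : ∀ x y → x ∈ A → y ∈ A → x ≢ y → G x y ≡ true) where

  join-via-A : {P : Fin n → Set} {x y a a′ : Fin n} → a ∈ A → a′ ∈ A →
               Walk G P x a → Walk G P y a′ → Walk G P x y
  join-via-A {a = a} {a′} a∈A a′∈A w w′ with a ≟ a′
  ... | yes refl = w ++ʷ reverse w′
  ... | no a≢a′  = w ++ʷ (last w ∷⟨ inj₁ (A-clique a a′ a∈A a′∈A a≢a′) ⟩ reverse w′)

  -- In the rewired graph u only sees the clique A, so a walk through u can shortcut inside A.
  module _ {u : Fin n} (u∉A : u ∉ A) where

    open Rewire G A u

    reroute : {P : Fin n → Set} {x y : Fin n} → Walk (rewire G A u) P x y → y ≢ u →
      (x ≢ u → Walk G (λ z → P z × z ≢ u) x y) ×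
      (x ≡ u → ∃ λ a → a ∈ A × Walk G (λ z → P z × z ≢ u) a y)
    reroute [ p ] y≢u = (λ x≢u → [ p , x≢u ]) , (λ x≡u → ⊥-elim (y≢u x≡u))
    reroute {P = P} {x} (_∷⟨_⟩_ {y = z} p adj w) y≢u = from-x , from-u
      where
      rest = reroute w y≢u
      Q = λ z → P z × z ≢ u
      from-x : x ≢ u → Walk G Q x _
      from-x x≢u = via (z ≟ u)
        where
        enter-A : z ≡ u → (a : Fin n) → a ∈ A → Walk G Q a _ → Dec (x ≡ a) → Walk G Q x _
        enter-A z≡u a a∈A w′ (yes refl) = w′
        enter-A z≡u a a∈A w′ (no x≢a)   = (p , x≢u) ∷⟨ inj₁ (A-clique x a x∈A a∈A x≢a) ⟩ w′
          where x∈A = rewire-neighbour (subst (Adjacent (rewire G A u) x) z≡u adj)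
        via : Dec (z ≡ u) → Walk G Q x _
        via (no z≢u)  = (p , x≢u) ∷⟨ rewire⇒adjacent x≢u z≢u adj ⟩ proj₁ rest z≢u
        via (yes z≡u) = let a , a∈A , w′ = proj₂ rest z≡u in enter-A z≡u a a∈A w′ (x ≟ a)
      from-u : x ≡ u → ∃ λ a → a ∈ A × Walk G Q a _
      from-u x≡u = via (z ≟ u)
        where
        via : Dec (z ≡ u) → ∃ λ a → a ∈ A × Walk G Q a _
        via (yes z≡u) = ⊥-elim (u∉A (rewire-neighbour (subst₂ (Adjacent (rewire G A u)) x≡u z≡u adj)))
        via (no z≢u)  = z , rewire-neighbour (Adjacent-sym {G = rewire G A u} {x = u} {y = z}
                                                (subst (λ v → Adjacent (rewire G A u) v z) x≡u adj)) ,
                        proj₁ rest z≢u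

    -- If u shares its branch set with x₀, dropping u keeps the set connected (reroute) and
    -- every edge at u, which goes to A, is replaced by an edge from the A-vertex where the
    -- rerouted walk from u to x₀ starts.
    module _ {H : Graph m} (irr-H : Irreflexive H) (M : Model H (rewire G A u)) {h : Fin m}
             (βu : branch M u ≡ just h) {x₀ : Fin n} (x₀≢u : x₀ ≢ u) (βx₀ : branch M x₀ ≡ just h) where

      private
        β : Fin n → Maybe (Fin m)
        β x with x ≟ u
        ... | yes _ = nothing
        ... | no _  = branch M x

        β⁻ : ∀ x {j} → β x ≡ just j → x ≢ u × branch M x ≡ just j
        β⁻ x eq with x ≟ u
        ... | no x≢u = x≢u , eq

        β⁺ : ∀ x {j} → x ≢ u → branch M x ≡ just j → β x ≡ just j
        β⁺ x x≢u eq with x ≟ u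
        ... | yes x≡u = ⊥-elim (x≢u x≡u)
        ... | no _    = eq

        entry : ∃ λ a → a ∈ A × Walk G (λ z → branch M z ≡ just h × z ≢ u) a x₀
        entry = proj₂ (reroute (connected M h u x₀ βu βx₀) x₀≢u) refl

        a₀ = proj₁ entry
        a₀∈A = proj₁ (proj₂ entry)
        βa₀ = proj₁ (head (proj₂ (proj₂ entry)))
        a₀≢u = proj₂ (head (proj₂ (proj₂ entry)))

        distinct : ∀ {s t j j′} → branch M s ≡ just j → branch M t ≡ just j′ → H j j′ ≡ true → s ≢ t
        distinct {j = j} βs βt e refl =
          irr-H j (subst (λ w → H j w ≡ true) (sym (Maybeₚ.just-injective (trans (sym βs) βt))) e)

        linked′ : ∀ j j′ → H j j′ ≡ true → Linked G β j j′
        linked′ j j′ e with linked M j j′ e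
        ... | s , t , βs , βt , st = by-cases (s ≟ u) (t ≟ u)
          where
          by-cases : Dec (s ≡ u) → Dec (t ≡ u) → Linked G β j j′
          by-cases (yes refl) (yes refl) = ⊥-elim (u∉A (rewire-neighbour (inj₁ st)))
          by-cases (yes refl) (no t≢u) =
            let βa₀′ = trans βa₀ (trans (sym βu) βs) in
            a₀ , t , β⁺ a₀ a₀≢u βa₀′ , β⁺ t t≢u βt ,
            A-clique a₀ t a₀∈A (rewire-neighbour (inj₂ st)) (distinct βa₀′ βt e)
          by-cases (no s≢u) (yes refl) =
            let βa₀′ = trans βa₀ (trans (sym βu) βt) in
            s , a₀ , β⁺ s s≢u βs , β⁺ a₀ a₀≢u βa₀′ ,
            A-clique s a₀ (rewire-neighbour (inj₁ st)) a₀∈A (distinct βs βa₀′ e)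
          by-cases (no s≢u) (no t≢u) = s , t , β⁺ s s≢u βs , β⁺ t t≢u βt , rewire⇒edge s≢u t≢u st

      Model-rewire-drop-u : Model H G
      Model-rewire-drop-u = record
        { branch    = β
        ; inhabited = inhabited′
        ; connected = λ j x y βx βy →
            let x≢u , βx′ = β⁻ x βx ; y≢u , βy′ = β⁻ y βy in
            mapᵛ (λ z (βz , z≢u) → β⁺ z z≢u βz) (proj₁ (reroute (connected M j x y βx′ βy′) y≢u) x≢u)
        ; linked    = linked′
        }
        where
        inhabited′ : ∀ j → ∃ λ x → β x ≡ just j
        inhabited′ j with inhabited M j
        ... | x , βx with x ≟ u
        ...   | no x≢u  = x , β⁺ x x≢u βx
        ...   | yes refl = x₀ , β⁺ x₀ x₀≢u (trans βx₀ (trans (sym βu) βx))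

module Rewiring {k : ℕ} (G : Graph n) (sym-G : Symmetric G) (A B : Subset n)
  (A∩B≡∅ : ∀ x → x ∈ A → x ∉ B) (∣A∣≡1+k : ∣ A ∣ ≡ suc k) (2<∣B∣ : 2 < ∣ B ∣)
  (A-clique : ∀ x y → x ∈ A → y ∈ A → x ≢ y → G x y ≡ true)
  (A-B-complete : ∀ x y → x ∈ A → y ∈ B → G x y ≡ true)
  (u : Fin n) (u∉A : u ∉ A) where

  open Rewire G A u
  open import Data.List.Membership.DecPropositional (_≟_ {n = n}) using () renaming (_∈?_ to _∈ˡ?_)

  R : ℕ
  R = suc (suc (suc (suc k)))

  K : Graph R
  K = K=[ R ]

  G* : Graph n
  G* = rewire G A u

  all-but-two-meet-A⇒⊥ : (β : Fin n → Maybe (Fin R)) {p q : Fin R} → p ≢ q →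
                         (∀ j → j ≢ p → j ≢ q → Meets A β j) → ⊥
  all-but-two-meet-A⇒⊥ β p≢q meets =
    ℕₚ.<-irrefl refl (subst (suc (suc k) ≤_) ∣A∣≡1+k (all-but-two-meet⇒≤∣p∣ A β p≢q meets))

  module _ (M : Model K G*) {h : Fin R} (βu : branch M u ≡ just h)
           (alone : ∀ x → branch M x ≡ just h → x ≡ u) where

    neighbours-meet-A : ∀ j → K h j ≡ true → Meets A (branch M) j
    neighbours-meet-A j e with linked M h j e
    ... | s , t , βs , βt , st =
      t , rewire-neighbour (inj₂ (subst (λ w → G* w t ≡ true) (alone s βs) st)) , βt

    -- Every label other than 0 has at least R - 2 neighbours in K, more than ∣ A ∣.
    lone-label≡0 : h ≡ zero
    lone-label≡0 = by-cases h refl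
      where
      by-cases : ∀ h′ → h′ ≡ h → h′ ≡ zero
      by-cases zero     _     = refl
      by-cases (suc h′) refl  = ⊥-elim (all-but-two-meet-A⇒⊥ (branch M) (λ ()) λ
        { zero    j≢0 _   → ⊥-elim (j≢0 refl)
        ; (suc j) _   j≢h → neighbours-meet-A (suc j) (K=-suc-suc _ h′ j (j≢h ∘ sym ∘ cong suc)) })

  OnlyB : Fin n → Fin n → Set
  OnlyB y v = v ∉ A × (v ∈ B → v ≡ y)

  record Segment (y : Fin n) : Set where
    field
      c     : Fin n
      c∈B   : c ∈ B
      c≢y   : c ≢ y
      z     : Fin n
      c-z   : Adjacent G c z
      tail  : Walk G (OnlyB y) z y

  last-segment : {x y : Fin n} → Walk G (_∉ A) x y → Segment y ⊎ Walk G (OnlyB y) x y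
  last-segment {x} [ x∉A ] = inj₂ [ x∉A , (λ _ → refl) ]
  last-segment {x} {y} (_∷⟨_⟩_ {y = z} x∉A adj w) with last-segment w
  ... | inj₁ segment = inj₁ segment
  ... | inj₂ w′ with x Subsetₚ.∈? B | x ≟ y
  ...   | yes x∈B | no x≢y  = inj₁ (record { c = x ; c∈B = x∈B ; c≢y = x≢y ; z = z ; c-z = adj ; tail = w′ })
  ...   | yes _   | yes x≡y = inj₂ ((x∉A , λ _ → x≡y) ∷⟨ adj ⟩ w′)
  ...   | no x∉B  | _       = inj₂ ((x∉A , λ x∈B → ⊥-elim (x∉B x∈B)) ∷⟨ adj ⟩ w′)

  module LoneU (M : Model K G*) (βu : branch M u ≡ just zero)
               (alone : ∀ x → branch M x ≡ just zero → x ≡ u) where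

    pattern one   = suc zero
    pattern two   = suc (suc zero)
    pattern 3+_ i = suc (suc (suc i))

    A-meets : ∀ i → Meets A (branch M) (3+ i)
    A-meets i = neighbours-meet-A M βu alone (3+ i) refl

    label-0∉A : ∀ {a} → a ∈ A → branch M a ≢ just zero
    label-0∉A a∈A βa = u∉A (subst (_∈ A) (alone _ βa) a∈A)

    label-1∉A : ∀ {a} → a ∈ A → branch M a ≢ just one
    label-1∉A {a} a∈A βa = all-but-two-meet-A⇒⊥ (branch M) {zero} {two} (λ ()) λ
      { zero    j≢0 _   → ⊥-elim (j≢0 refl)
      ; one     _   _   → a , a∈A , βa
      ; two     _   j≢2 → ⊥-elim (j≢2 refl)
      ; (3+ i)  _   _   → A-meets i }

    label-2∉A : ∀ {a} → a ∈ A → branch M a ≢ just two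
    label-2∉A {a} a∈A βa = all-but-two-meet-A⇒⊥ (branch M) {zero} {one} (λ ()) λ
      { zero    j≢0 _   → ⊥-elim (j≢0 refl)
      ; one     _   j≢1 → ⊥-elim (j≢1 refl)
      ; two     _   _   → a , a∈A , βa
      ; (3+ i)  _   _   → A-meets i }

    ≢u : ∀ {x j} → branch M x ≡ just j → j ≢ zero → x ≢ u
    ≢u βx j≢0 refl = j≢0 (Maybeₚ.just-injective (trans (sym βx) βu))

    module AgreeingOnA (β : Fin n → Maybe (Fin R)) (β-A : ∀ a → a ∈ A → β a ≡ branch M a) where

      A-rep : ∀ i → Meets A β (3+ i)
      A-rep i = let a , a∈A , βa = A-meets i in a , a∈A , trans (β-A a a∈A) βa

      B-A-linked : ∀ {b j} → b ∈ B → β b ≡ just j → ∀ i → Linked G β j (3+ i)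
      B-A-linked {b} b∈B βb i =
        let a , a∈A , βa = A-rep i in b , a , βb , βa , trans (sym-G b a) (A-B-complete a b a∈A b∈B)

      A-A-linked : ∀ i i′ → i ≢ i′ → Linked G β (3+ i) (3+ i′)
      A-A-linked i i′ i≢i′ =
        let a , a∈A , βa = A-rep i ; a′ , a′∈A , βa′ = A-rep i′ in
        a , a′ , βa , βa′ ,
        A-clique a a′ a∈A a′∈A λ a≡a′ → i≢i′ (3+-injective (trans (sym βa) (trans (cong β a≡a′) βa′)))
        where
        3+-injective : ∀ {i i′} → just (3+ i) ≡ just (3+ i′) → i ≡ i′
        3+-injective refl = refl

      A-connected : ∀ i x y → x ∈ A → y ∈ A → β x ≡ just (3+ i) → β y ≡ just (3+ i) →
                    Walk G (λ z → β z ≡ just (3+ i)) x y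
      A-connected i x y x∈A y∈A βx βy = join-via-A A-clique x∈A y∈A [ βx ] [ βy ]

    -- A third vertex b₃ of B becomes branch 0, c branch 1 and the tail branch 2.
    module Separation {y : Fin n} (y∈B : y ∈ B) (seg : Segment y) where
      open Segment seg

      private
        b₃-spec = ∃∈p-avoiding-two {p = B} 2<∣B∣ c y
        b₃  = proj₁ b₃-spec
        b₃∈B = proj₁ (proj₂ b₃-spec)
        b₃≢c = proj₁ (proj₂ (proj₂ b₃-spec))
        b₃≢y = proj₂ (proj₂ (proj₂ b₃-spec))

      β : Fin n → Maybe (Fin R)
      β x with x Subsetₚ.∈? A | x ≟ b₃ | x ≟ c | x ∈ˡ? vertices tail
      ... | yes _ | _     | _     | _     = branch M x
      ... | no _  | yes _ | _     | _     = just zero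
      ... | no _  | no _  | yes _ | _     = just one
      ... | no _  | no _  | no _  | yes _ = just two
      ... | no _  | no _  | no _  | no _  = nothing

      β-A : ∀ a → a ∈ A → β a ≡ branch M a
      β-A a a∈A with a Subsetₚ.∈? A | a ≟ b₃ | a ≟ c | a ∈ˡ? vertices tail
      ... | yes _ | _ | _ | _ = refl
      ... | no a∉A | _ | _ | _ = ⊥-elim (a∉A a∈A)

      β-b₃ : β b₃ ≡ just zero
      β-b₃ with b₃ Subsetₚ.∈? A | b₃ ≟ b₃ | b₃ ≟ c | b₃ ∈ˡ? vertices tail
      ... | yes b₃∈A | _ | _ | _ = ⊥-elim (A∩B≡∅ b₃ b₃∈A b₃∈B)
      ... | no _ | yes _ | _ | _ = refl
      ... | no _ | no b₃≢b₃ | _ | _ = ⊥-elim (b₃≢b₃ refl)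

      β-c : β c ≡ just one
      β-c with c Subsetₚ.∈? A | c ≟ b₃ | c ≟ c | c ∈ˡ? vertices tail
      ... | yes c∈A | _ | _ | _ = ⊥-elim (A∩B≡∅ c c∈A c∈B)
      ... | no _ | yes c≡b₃ | _ | _ = ⊥-elim (b₃≢c (sym c≡b₃))
      ... | no _ | no _ | yes _ | _ = refl
      ... | no _ | no _ | no c≢c | _ = ⊥-elim (c≢c refl)

      β-tail : ∀ {v} → v ∈ˡ vertices tail → β v ≡ just two
      β-tail {v} v∈ with v Subsetₚ.∈? A | v ≟ b₃ | v ≟ c | v ∈ˡ? vertices tail
      ... | yes v∈A | _ | _ | _ = ⊥-elim (proj₁ (∈-vertices⁻ tail v∈) v∈A)
      ... | no _ | yes refl | _ | _ = ⊥-elim (b₃≢y (proj₂ (∈-vertices⁻ tail v∈) b₃∈B))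
      ... | no _ | no _ | yes refl | _ = ⊥-elim (c≢y (proj₂ (∈-vertices⁻ tail v∈) c∈B))
      ... | no _ | no _ | no _ | yes _ = refl
      ... | no _ | no _ | no _ | no v∉ = ⊥-elim (v∉ v∈)

      β⁻ : ∀ x {j} → β x ≡ just j →
           (x ∈ A × branch M x ≡ just j) ⊎ (x ≡ b₃ × j ≡ zero) ⊎
           (x ≡ c × j ≡ one) ⊎ (x ∈ˡ vertices tail × j ≡ two)
      β⁻ x eq with x Subsetₚ.∈? A | x ≟ b₃ | x ≟ c | x ∈ˡ? vertices tail
      β⁻ x eq    | yes x∈A | _ | _ | _ = inj₁ (x∈A , eq)
      β⁻ x refl  | no _ | yes x≡b₃ | _ | _ = inj₂ (inj₁ (x≡b₃ , refl))
      β⁻ x refl  | no _ | no _ | yes x≡c | _ = inj₂ (inj₂ (inj₁ (x≡c , refl)))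
      β⁻ x refl  | no _ | no _ | no _ | yes x∈ = inj₂ (inj₂ (inj₂ (x∈ , refl)))

      branch-0 : ∀ x → β x ≡ just zero → x ≡ b₃
      branch-0 x βx with β⁻ x βx
      ... | inj₁ (x∈A , βx′)                = ⊥-elim (label-0∉A x∈A βx′)
      ... | inj₂ (inj₁ (x≡b₃ , _))          = x≡b₃
      ... | inj₂ (inj₂ (inj₁ (_ , ())))
      ... | inj₂ (inj₂ (inj₂ (_ , ())))

      branch-1 : ∀ x → β x ≡ just one → x ≡ c
      branch-1 x βx with β⁻ x βx
      ... | inj₁ (x∈A , βx′)                = ⊥-elim (label-1∉A x∈A βx′)
      ... | inj₂ (inj₁ (_ , ()))
      ... | inj₂ (inj₂ (inj₁ (x≡c , _)))    = x≡c
      ... | inj₂ (inj₂ (inj₂ (_ , ())))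

      branch-2 : ∀ x → β x ≡ just two → x ∈ˡ vertices tail
      branch-2 x βx with β⁻ x βx
      ... | inj₁ (x∈A , βx′)                = ⊥-elim (label-2∉A x∈A βx′)
      ... | inj₂ (inj₁ (_ , ()))
      ... | inj₂ (inj₂ (inj₁ (_ , ())))
      ... | inj₂ (inj₂ (inj₂ (x∈ , _)))     = x∈

      branch-3+ : ∀ x i → β x ≡ just (3+ i) → x ∈ A
      branch-3+ x i βx with β⁻ x βx
      ... | inj₁ (x∈A , _)               = x∈A
      ... | inj₂ (inj₁ (_ , ()))
      ... | inj₂ (inj₂ (inj₁ (_ , ())))
      ... | inj₂ (inj₂ (inj₂ (_ , ())))

      open AgreeingOnA β β-A

      model : Model K G
      model = record { branch = β ; inhabited = inhabited′ ; connected = connected′ ; linked = linked′ }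
        where
        inhabited′ : ∀ j → ∃ λ x → β x ≡ just j
        inhabited′ zero   = b₃ , β-b₃
        inhabited′ one    = c , β-c
        inhabited′ two    = y , β-tail (end∈vertices tail)
        inhabited′ (3+ i) = let a , _ , βa = A-rep i in a , βa

        connected′ : ∀ j x y → β x ≡ just j → β y ≡ just j → Walk G (λ z → β z ≡ just j) x y
        connected′ zero   x y βx βy = trivial (trans (branch-0 x βx) (sym (branch-0 y βy))) βx
        connected′ one    x y βx βy = trivial (trans (branch-1 x βx) (sym (branch-1 y βy))) βx
        connected′ two    x y βx βy = mapᵛ (λ _ → β-tail)
          (walk-within-vertices tail (branch-2 x βx) ++ʷ reverse (walk-within-vertices tail (branch-2 y βy)))
        connected′ (3+ i) x y βx βy = A-connected i x y (branch-3+ x i βx) (branch-3+ y i βy) βx βy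

        linked′ : ∀ j j′ → K j j′ ≡ true → Linked G β j j′
        linked′ = K=-linked sym-G β
          (B-A-linked b₃∈B β-b₃)
          (c , z , β-c , β-tail (start∈vertices tail) , Adjacent⇒edge sym-G c-z)
          (B-A-linked c∈B β-c)
          (B-A-linked y∈B (β-tail (end∈vertices tail)))
          A-A-linked

    separation : ∀ {b b′} → b ∈ B → b′ ∈ B → b ≢ b′ → Walk G (_∉ A) b b′ → Model K G
    separation b∈B b′∈B b≢b′ w with last-segment w
    ... | inj₁ seg = Separation.model b′∈B seg
    ... | inj₂ w′  = ⊥-elim (b≢b′ (proj₂ (head w′) b∈B))

    OneTwo : Fin R → Set
    OneTwo j = j ≡ one ⊎ j ≡ two

    OneTwo⇒≢0 : ∀ {j} → OneTwo j → j ≢ zero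
    OneTwo⇒≢0 (inj₁ refl) ()
    OneTwo⇒≢0 (inj₂ refl) ()

    OneTwo⇒∉A : ∀ {x j} → OneTwo j → branch M x ≡ just j → x ∉ A
    OneTwo⇒∉A (inj₁ refl) βx x∈A = label-1∉A x∈A βx
    OneTwo⇒∉A (inj₂ refl) βx x∈A = label-2∉A x∈A βx

    branch-walk : ∀ {j x y} → j ≢ zero → branch M x ≡ just j → branch M y ≡ just j →
                  Walk G (λ z → branch M z ≡ just j) x y
    branch-walk j≢0 βx βy = rewire⇒walk (λ z βz → ≢u βz j≢0) (connected M _ _ _ βx βy)

    Reach : Fin n → Set
    Reach x = ∃ λ s → branch M s ≡ just one × Walk G (_∉ A) s x

    reach-step : ∀ {x z} → Reach x → z ∉ A → Adjacent G x z → Reach z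
    reach-step (s , βs , w) z∉A adj = s , βs , snoc w adj z∉A

    reach-1 : ∀ {x y} → branch M x ≡ just one → branch M y ≡ just one → Walk G (_∉ A) x y
    reach-1 βx βy = mapᵛ (λ z βz → OneTwo⇒∉A (inj₁ refl) βz) (branch-walk (λ ()) βx βy)

    reach-branch : ∀ {x j} → OneTwo j → branch M x ≡ just j → Reach x
    reach-branch {x} (inj₁ refl) βx = x , βx , [ OneTwo⇒∉A (inj₁ refl) βx ]
    reach-branch {x} (inj₂ refl) βx with linked M one two refl
    ... | s , t , βs , βt , st =
      s , βs , OneTwo⇒∉A (inj₁ refl) βs ∷⟨ inj₁ (rewire⇒edge (≢u βs (λ ())) (≢u βt (λ ())) st) ⟩
               mapᵛ (λ z βz → OneTwo⇒∉A (inj₂ refl) βz) (branch-walk (λ ()) βt βx)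

    -- If some b ∈ B is not reachable from branch 1 outside A, b replaces u in branch 0; the
    -- branches 3,… are cut down to A and the reachable part, which still connects them to A.
    module Substitution (Reach? : ∀ x → Dec (Reach x)) {b : Fin n} (b∈B : b ∈ B) (¬reach-b : ¬ Reach b) where

      Kept : Fin n → Set
      Kept x = x ∈ A ⊎ Reach x

      β : Fin n → Maybe (Fin R)
      β x with x ≟ b | x Subsetₚ.∈? A | Reach? x | x ≟ u
      ... | yes _ | _     | _     | _     = just zero
      ... | no _  | yes _ | _     | _     = branch M x
      ... | no _  | no _  | yes _ | no _  = branch M x
      ... | no _  | no _  | yes _ | yes _ = nothing
      ... | no _  | no _  | no _  | _     = nothing

      β-b : β b ≡ just zero
      β-b with b ≟ b | b Subsetₚ.∈? A | Reach? b | b ≟ u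
      ... | yes _ | _ | _ | _ = refl
      ... | no b≢b | _ | _ | _ = ⊥-elim (b≢b refl)

      β-kept : ∀ {x j} → Kept x → branch M x ≡ just j → j ≢ zero → β x ≡ just j
      β-kept {x} kept βx j≢0 with x ≟ b | x Subsetₚ.∈? A | Reach? x | x ≟ u
      ... | yes refl | _ | _ | _ with kept
      ...   | inj₁ b∈A   = ⊥-elim (A∩B≡∅ b b∈A b∈B)
      ...   | inj₂ reach = ⊥-elim (¬reach-b reach)
      β-kept kept βx j≢0 | no _ | yes _ | _ | _ = βx
      β-kept kept βx j≢0 | no _ | no _ | yes _ | no _ = βx
      β-kept kept βx j≢0 | no _ | no _ | yes _ | yes x≡u = ⊥-elim (≢u βx j≢0 x≡u)
      β-kept kept βx j≢0 | no _ | no x∉A | no ¬reach | _ with kept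
      ...   | inj₁ x∈A   = ⊥-elim (x∉A x∈A)
      ...   | inj₂ reach = ⊥-elim (¬reach reach)

      β-OneTwo : ∀ {x j} → OneTwo j → branch M x ≡ just j → β x ≡ just j
      β-OneTwo j∈ βx = β-kept (inj₂ (reach-branch j∈ βx)) βx (OneTwo⇒≢0 j∈)

      β-A : ∀ a → a ∈ A → β a ≡ branch M a
      β-A a a∈A with a ≟ b | a Subsetₚ.∈? A | Reach? a | a ≟ u
      ... | yes refl | _ | _ | _ = ⊥-elim (A∩B≡∅ a a∈A b∈B)
      ... | no _ | yes _ | _ | _ = refl
      ... | no _ | no a∉A | _ | _ = ⊥-elim (a∉A a∈A)

      β⁻ : ∀ x {j} → β x ≡ just j →
           (x ≡ b × j ≡ zero) ⊎ (x ∈ A × branch M x ≡ just j) ⊎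
           (x ∉ A × Reach x × x ≢ u × branch M x ≡ just j)
      β⁻ x eq with x ≟ b | x Subsetₚ.∈? A | Reach? x | x ≟ u
      β⁻ x refl | yes x≡b | _ | _ | _ = inj₁ (x≡b , refl)
      β⁻ x eq | no _ | yes x∈A | _ | _ = inj₂ (inj₁ (x∈A , eq))
      β⁻ x eq | no _ | no x∉A | yes reach | no x≢u = inj₂ (inj₂ (x∉A , reach , x≢u , eq))

      branch-0 : ∀ x → β x ≡ just zero → x ≡ b
      branch-0 x βx with β⁻ x βx
      ... | inj₁ (x≡b , _) = x≡b
      ... | inj₂ (inj₁ (x∈A , βx′)) = ⊥-elim (label-0∉A x∈A βx′)
      ... | inj₂ (inj₂ (_ , _ , x≢u , βx′)) = ⊥-elim (x≢u (alone x βx′))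

      branch-OneTwo : ∀ x {j} → OneTwo j → β x ≡ just j → branch M x ≡ just j
      branch-OneTwo x j∈ βx with β⁻ x βx
      ... | inj₁ (_ , refl)               = ⊥-elim (OneTwo⇒≢0 j∈ refl)
      ... | inj₂ (inj₁ (x∈A , βx′))       = ⊥-elim (OneTwo⇒∉A j∈ βx′ x∈A)
      ... | inj₂ (inj₂ (_ , _ , _ , βx′)) = βx′

      prefix-to-A : ∀ {S : Fin n → Set} {x y} → Walk G S x y → y ∈ A → x ∉ A → Reach x →
                    ∃ λ a → a ∈ A × Walk G (λ z → S z × Kept z) x a
      prefix-to-A [ _ ] y∈A x∉A _ = ⊥-elim (x∉A y∈A)
      prefix-to-A {x = x} (_∷⟨_⟩_ {y = z} p adj w) y∈A x∉A reach-x = by-cases (z Subsetₚ.∈? A)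
        where
        by-cases : Dec (z ∈ A) → ∃ λ a → a ∈ A × Walk G _ x a
        by-cases (yes z∈A) = z , z∈A , (p , inj₂ reach-x) ∷⟨ adj ⟩ [ head w , inj₁ z∈A ]
        by-cases (no z∉A)  = let a , a∈A , w′ = prefix-to-A w y∈A z∉A (reach-step reach-x z∉A adj) in
                             a , a∈A , (p , inj₂ reach-x) ∷⟨ adj ⟩ w′

      open AgreeingOnA β β-A

      walk-to-A : ∀ x i → β x ≡ just (3+ i) → ∃ λ a → a ∈ A × Walk G (λ z → β z ≡ just (3+ i)) x a
      walk-to-A x i βx with β⁻ x βx
      ... | inj₂ (inj₁ (x∈A , _)) = x , x∈A , [ βx ]
      ... | inj₂ (inj₂ (x∉A , reach , _ , βx′)) =
        let a₀ , a₀∈A , βa₀ = A-meets i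
            a , a∈A , w = prefix-to-A (branch-walk (λ ()) βx′ βa₀) a₀∈A x∉A reach
        in a , a∈A , mapᵛ (λ z (βz , kept) → β-kept kept βz (λ ())) w

      OneTwo-linked : ∀ j j′ → j ≢ zero → j′ ≢ zero → K j j′ ≡ true → OneTwo j → Linked G β j j′
      OneTwo-linked j j′ j≢0 j′≢0 e j∈ with linked M j j′ e
      ... | s , t , βs , βt , st = s , t , β-kept (inj₂ reach-s) βs j≢0 , β-kept kept-t βt j′≢0 , st′
        where
        st′ = rewire⇒edge (≢u βs j≢0) (≢u βt j′≢0) st
        reach-s = reach-branch j∈ βs
        kept-t : Kept t
        kept-t with t Subsetₚ.∈? A
        ... | yes t∈A = inj₁ t∈A
        ... | no t∉A  = inj₂ (reach-step reach-s t∉A (inj₁ st′))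

      model : Model K G
      model = record { branch = β ; inhabited = inhabited′ ; connected = connected′ ; linked = linked′ }
        where
        inhabited′ : ∀ j → ∃ λ x → β x ≡ just j
        inhabited′ zero   = b , β-b
        inhabited′ one    = let x , βx = inhabited M one in x , β-OneTwo (inj₁ refl) βx
        inhabited′ two    = let x , βx = inhabited M two in x , β-OneTwo (inj₂ refl) βx
        inhabited′ (3+ i) = let a , _ , βa = A-rep i in a , βa

        OneTwo-connected : ∀ j → OneTwo j → ∀ x y → β x ≡ just j → β y ≡ just j →
                           Walk G (λ z → β z ≡ just j) x y
        OneTwo-connected j j∈ x y βx βy =
          mapᵛ (λ z → β-OneTwo j∈)
               (branch-walk (OneTwo⇒≢0 j∈) (branch-OneTwo x j∈ βx) (branch-OneTwo y j∈ βy))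

        connected′ : ∀ j x y → β x ≡ just j → β y ≡ just j → Walk G (λ z → β z ≡ just j) x y
        connected′ zero   x y βx βy = trivial (trans (branch-0 x βx) (sym (branch-0 y βy))) βx
        connected′ one    = OneTwo-connected one (inj₁ refl)
        connected′ two    = OneTwo-connected two (inj₂ refl)
        connected′ (3+ i) x y βx βy =
          let a , a∈A , w = walk-to-A x i βx ; a′ , a′∈A , w′ = walk-to-A y i βy in
          join-via-A A-clique a∈A a′∈A w w′

        linked′ : ∀ j j′ → K j j′ ≡ true → Linked G β j j′
        linked′ = K=-linked sym-G β
          (B-A-linked b∈B β-b)
          (OneTwo-linked one two (λ ()) (λ ()) refl (inj₁ refl))
          (λ i → OneTwo-linked one (3+ i) (λ ()) (λ ()) refl (inj₁ refl))
          (λ i → OneTwo-linked two (3+ i) (λ ()) (λ ()) refl (inj₂ refl))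
          A-A-linked

    lone-u-model : (∀ x → Dec (Reach x)) → Model K G
    lone-u-model Reach? with Finₚ.any? (λ b → b Subsetₚ.∈? B ×-dec ¬? (Reach? b))
    ... | yes (b , b∈B , ¬reach-b) = Substitution.model Reach? b∈B ¬reach-b
    ... | no none =
      let b₁ , b₁∈B , _ , _    = ∃∈p-avoiding-two {p = B} 2<∣B∣ u u
          b₂ , b₂∈B , b₂≢b₁ , _ = ∃∈p-avoiding-two {p = B} 2<∣B∣ b₁ b₁
          s₁ , βs₁ , w₁ = reach b₁∈B
          s₂ , βs₂ , w₂ = reach b₂∈B
      in separation b₁∈B b₂∈B (b₂≢b₁ ∘ sym) (reverse w₁ ++ʷ reach-1 βs₁ βs₂ ++ʷ w₂)
      where
      reach : ∀ {x} → x ∈ B → Reach x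
      reach {x} x∈B with Reach? x
      ... | yes reach-x  = reach-x
      ... | no ¬reach-x  = ⊥-elim (none (x , x∈B , ¬reach-x))

    lone-u : ¬ ¬ Model K G
    lone-u ¬model = ¬¬-decidable Reach (¬model ∘ lone-u-model)

  rewired-model⇒¬¬model : Model K G* → ¬ ¬ Model K G
  rewired-model⇒¬¬model M with branch M u in βu
  ... | nothing = λ ¬model → ¬model (Model-rewire-unused M βu)
  ... | just h with Finₚ.any? (λ x → ¬? (x ≟ u) ×-dec Maybeₚ.≡-dec _≟_ (branch M x) (just h))
  ...   | yes (x₀ , x₀≢u , βx₀) =
    λ ¬model → ¬model (Model-rewire-drop-u A-clique u∉A (K=-irr R) M βu x₀≢u βx₀)
  ...   | no none = LoneU.lone-u M (subst (λ j → branch M u ≡ just j) h≡0 βu) alone₀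
    where
    alone : ∀ x → branch M x ≡ just h → x ≡ u
    alone x βx with x ≟ u
    ... | yes x≡u = x≡u
    ... | no x≢u  = ⊥-elim (none (x , x≢u , βx))
    h≡0 : h ≡ zero
    h≡0 = lone-label≡0 M βu alone
    alone₀ : ∀ x → branch M x ≡ just zero → x ≡ u
    alone₀ x βx = alone x (subst (λ j → branch M x ≡ just j) (sym h≡0) βx)

large-B : ∀ {r b} → 4 ≤ r → r + n < 2 * b → 2 < b
large-B {n} {r} {b} 4≤r r+n<2b with 3 ℕₚ.≤? b
... | yes 3≤b = 3≤b
... | no 3≰b  = ⊥-elim (ℕₚ.<⇒≱ r+n<2b (begin
  2 * b   ≤⟨ ℕₚ.*-monoʳ-≤ 2 (ℕₚ.≤-pred (ℕₚ.≰⇒> 3≰b)) ⟩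
  4       ≤⟨ 4≤r ⟩
  r       ≤⟨ ℕₚ.m≤m+n r n ⟩
  r + n   ∎))
  where open ℕₚ.≤-Reasoning

theorem4p3 : (r n : ℕ) → 4 ≤ r → (G : Graph n) → IsSimple G →
    MinorFree K=[ r ] G →
    (A B : Subset n) →
    ((x : Fin n) → x ∈ A → x ∉ B) →
    ∣ A ∣ ≡ r ∸ 3 →
    r + n < 2 * ∣ B ∣ →
    ((x y : Fin n) → x ∈ A → y ∈ A → x ≢ y → G x y ≡ true) →
    ((x y : Fin n) → x ∈ A → y ∈ B → G x y ≡ true) →
    (u : Fin n) → u ∉ A → u ∉ B →
    MinorFree K=[ r ] (rewire G A u)
-- Matching on 4 ≤ r makes r a successor four times, so r ∸ 3 computes to 1 + k.
theorem4p3 r n 4≤r@(s≤s (s≤s (s≤s (s≤s _)))) G (sym-G , _) K⋠G A B A∩B≡∅ ∣A∣≡r∸3 r+n<2∣B∣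
           A-clique A-B-complete u u∉A _ K≼G* =
  rewired-model⇒¬¬model (≼⇒Model K≼G*) (K⋠G ∘ Model⇒≼ (K=-sym r) (K=-irr r) n)
  where
  open Rewiring G sym-G A B A∩B≡∅ ∣A∣≡r∸3 (large-B 4≤r r+n<2∣B∣) A-clique A-B-complete u u∉A
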